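{- Let $B>1$ and $N>1$ be integers with $\gcd(N,B)=1$, let $e=\operatorname{ord}(B,N)$, and let $e=dk$ with $d,k$ positive integers. Let $N^*=\{x\in\mathbb{Z}: 1\le x<N,\ \gcd(x,N)=1\}$. For $x\in N^*$ define $x_1=x$, $a_i=\lfloor Bx_i/N\rfloor$, $x_{i+1}=Bx_i-a_iN$ ($i\ge1$), $A_j=\sum_{i=1}^{k} a_{(j-1)k+i}B^{k-i}$ for $1\le j\le d$, $R_d(x)=\sum_{j=1}^d x_{(j-1)k+1}$ and $S_d(x)=\sum_{j=1}^d A_j$. Say that $N\in M_d(B)$ if $S_d(x)\equiv 0\pmod{B^k-1}$ for every $x\in N^*$. Then the following are equivalent: (i) $N\in M_d(B)$; (ii) for some $x\in N^*$, $S_d(x)\equiv 0\pmod{B^k-1}$; (iii) for some $x\in N^*$, $R_d(x)\equiv 0 \pmod N$; (iv) $B^{k(d-1)}+B^{k(d-2)}+\dots+B^k+1\equiv 0\pmod N$. Furthermore, if $\gcd(B^k-1,N)=1$ then $N\in M_d(B)$.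
   Context: $\operatorname{ord}(B,N)$ is the least positive integer $e$ with $B^e\equiv1\pmod N$. The $a_i$ are the base-$B$ digits of $x/N=0.a_1a_2\ldots$ (period $a_1\ldots a_e$), the $x_i$ are the successive remainders of long division, and $A_j$ is the integer represented in base $B$ by the $j$-th block of $k$ consecutive digits of the period. -}

module Defs where

open import Data.Nat using (ℕ; zero; suc; _+_; _*_; _∸_; _^_; _≤_; _<_; NonZero)
open import Data.Nat.DivMod using (_/_; _%_)
open import Data.Nat.Divisibility using (_∣_)
open import Data.Nat.Coprimality using (Coprime)
open import Data.Product using (_×_; ∃-syntax)
open import Relation.Binary.PropositionalEquality using (_≡_)

sumTo : ℕ → (ℕ → ℕ) → ℕ
sumTo zero    f = 0
sumTo (suc n) f = sumTo n f + f n

IsOrd : (B N e : ℕ) → .{{_ : NonZero N}} → Set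
IsOrd B N e = (0 < e × (B ^ e) % N ≡ 1 % N)
            × (∀ e′ → 0 < e′ → (B ^ e′) % N ≡ 1 % N → e ≤ e′)

InNStar : (N x : ℕ) → Set
InNStar N x = 1 ≤ x × x < N × Coprime x N

module LongDivision (B N : ℕ) .{{_ : NonZero N}} (x : ℕ) where
  -- rem i = x_{i+1}  (so rem 0 = x_1 = x);  x_{i+1} = B x_i - a_i N = (B x_i) mod N
  -- since a_i = ⌊B x_i / N⌋.
  rem : ℕ → ℕ
  rem zero    = x
  rem (suc i) = (B * rem i) % N

  -- digit i = a_{i+1} = ⌊B x_{i+1} / N⌋
  digit : ℕ → ℕ
  digit i = (B * rem i) / N

  -- block j k = A_{j+1} = Σ_{i=1}^{k} a_{jk+i} B^{k-i}
  block : (k j : ℕ) → ℕ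
  block k j = sumTo k (λ i → digit (j * k + i) * B ^ (k ∸ suc i))

  R : (d k : ℕ) → ℕ
  R d k = sumTo d (λ j → rem (j * k))

  S : (d k : ℕ) → ℕ
  S d k = sumTo d (λ j → block k j)

-- N ∈ M_d(B)   (k = e/d is passed explicitly)
InM : (B N d k : ℕ) → .{{_ : NonZero N}} → Set
InM B N d k = ∀ x → InNStar N x → (B ^ k ∸ 1) ∣ LongDivision.S B N x d k

{-# OPTIONS --safe #-}

-- Long division gives B^k x_{jk+1} = N A_{j+1} + x_{(j+1)k+1}.  Summed over a full period
-- (x_{dk+1} = x_1 because B^{dk} ≡ 1 mod N) this yields (B^k - 1) R_d(x) = N S_d(x), so
-- B^k - 1 ∣ S_d(x) iff N ∣ R_d(x); when gcd(B^k - 1, N) = 1 the identity forces N ∣ R_d(x).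
-- Since x_{i+1} ≡ B^i x (mod N), R_d(x) ≡ x (1 + B^k + ... + B^{k(d-1)}) (mod N), and x is a
-- unit mod N, so N ∣ R_d(x) iff N divides the geometric sum, a condition independent of x.
-- Only B^e ≡ 1 (mod N) is used, not the minimality of e.

module Submission where

open import Defs
open import Data.Nat using (ℕ; zero; suc; _+_; _*_; _∸_; _^_; _<_; NonZero; >-nonZero)
open import Data.Nat.DivMod using (_%_; m≡m%n+[m/n]*n; m<n⇒m%n≡m; m%n<n; [m+kn]%n≡m%n; %-distribˡ-*)
open import Data.Nat.Divisibility
  using (_∣_; ∣m∣n⇒∣m+n; ∣m+n∣m⇒∣n; m∣m*n; ∣n⇒∣m*n; *-monoʳ-∣; *-cancelˡ-∣)
open import Data.Nat.Coprimality using (Coprime; coprime-divisor; 1-coprimeTo)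
import Data.Nat.Coprimality as Coprime
open import Data.Nat.Properties
open import Algebra.Properties.CommutativeSemigroup +-commutativeSemigroup
  using (interchange; xy∙z≈xz∙y)
open import Algebra.Properties.CommutativeSemigroup *-commutativeSemigroup
  using () renaming (x∙yz≈y∙xz to x*[y*z]≡y*[x*z])
open import Data.Product using (_×_; ∃-syntax; _,_)
open import Function.Bundles using (_⇔_; mk⇔; Equivalence)
open import Function.Properties.Equivalence using () renaming (trans to ⇔-trans; sym to ⇔-sym)
open import Relation.Binary.PropositionalEquality
open ≡-Reasoning

sumTo-cong< : ∀ n {f g : ℕ → ℕ} → (∀ {i} → i < n → f i ≡ g i) → sumTo n f ≡ sumTo n g
sumTo-cong< zero    f≗g = refl
sumTo-cong< (suc n) f≗g = cong₂ _+_ (sumTo-cong< n (λ i<n → f≗g (m<n⇒m<1+n i<n))) (f≗g ≤-refl)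

sumTo-cong : ∀ n {f g : ℕ → ℕ} → (∀ i → f i ≡ g i) → sumTo n f ≡ sumTo n g
sumTo-cong n f≗g = sumTo-cong< n (λ {i} _ → f≗g i)

*-distribˡ-sumTo : ∀ c n (f : ℕ → ℕ) → c * sumTo n f ≡ sumTo n (λ i → c * f i)
*-distribˡ-sumTo c zero    f = *-zeroʳ c
*-distribˡ-sumTo c (suc n) f = begin
  c * (sumTo n f + f n)             ≡⟨ *-distribˡ-+ c (sumTo n f) (f n) ⟩
  c * sumTo n f + c * f n           ≡⟨ cong (_+ c * f n) (*-distribˡ-sumTo c n f) ⟩
  sumTo n (λ i → c * f i) + c * f n ∎

sumTo-+ : ∀ n (f g : ℕ → ℕ) → sumTo n (λ i → f i + g i) ≡ sumTo n f + sumTo n g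
sumTo-+ zero    f g = refl
sumTo-+ (suc n) f g = begin
  sumTo n (λ i → f i + g i) + (f n + g n)   ≡⟨ cong (_+ (f n + g n)) (sumTo-+ n f g) ⟩
  sumTo n f + sumTo n g + (f n + g n)       ≡⟨ interchange (sumTo n f) (sumTo n g) (f n) (g n) ⟩
  sumTo n f + f n + (sumTo n g + g n)       ∎

sumTo-shift : ∀ n (f : ℕ → ℕ) → sumTo n (λ i → f (suc i)) + f 0 ≡ sumTo n f + f n
sumTo-shift zero    f = refl
sumTo-shift (suc n) f = begin
  sumTo n (λ i → f (suc i)) + f (suc n) + f 0 ≡⟨ xy∙z≈xz∙y _ (f (suc n)) (f 0) ⟩
  sumTo n (λ i → f (suc i)) + f 0 + f (suc n) ≡⟨ cong (_+ f (suc n)) (sumTo-shift n f) ⟩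
  sumTo n f + f n + f (suc n)                 ∎

sumTo-rotate : ∀ n (f : ℕ → ℕ) → f n ≡ f 0 → sumTo n (λ i → f (suc i)) ≡ sumTo n f
sumTo-rotate n f fn≡f0 = +-cancelʳ-≡ (f 0) _ _ (begin
  sumTo n (λ i → f (suc i)) + f 0 ≡⟨ sumTo-shift n f ⟩
  sumTo n f + f n                 ≡⟨ cong (sumTo n f +_) fn≡f0 ⟩
  sumTo n f + f 0                 ∎)

sumTo-horner : ∀ b m (g : ℕ → ℕ) →
  sumTo (suc m) (λ i → g i * b ^ (suc m ∸ suc i)) ≡ b * sumTo m (λ i → g i * b ^ (m ∸ suc i)) + g m
sumTo-horner b m g = begin
  sumTo m (λ i → g i * b ^ (m ∸ i)) + g m * b ^ (m ∸ m)
    ≡⟨ cong₂ _+_ (sumTo-cong< m shift) (cong (λ t → g m * b ^ t) (n∸n≡0 m)) ⟩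
  sumTo m (λ i → b * (g i * b ^ (m ∸ suc i))) + g m * 1
    ≡⟨ cong₂ _+_ (sym (*-distribˡ-sumTo b m _)) (*-identityʳ (g m)) ⟩
  b * sumTo m (λ i → g i * b ^ (m ∸ suc i)) + g m ∎
  where
  shift : ∀ {i} → i < m → g i * b ^ (m ∸ i) ≡ b * (g i * b ^ (m ∸ suc i))
  shift {i} i<m = begin
    g i * b ^ (m ∸ i)             ≡⟨ cong (λ t → g i * b ^ t) (+-∸-assoc 1 i<m) ⟩
    g i * (b * b ^ (m ∸ suc i))   ≡⟨ x*[y*z]≡y*[x*z] (g i) b _ ⟩
    b * (g i * b ^ (m ∸ suc i))   ∎

∣-cross : ∀ {c n r s} .{{_ : NonZero c}} → c * r ≡ n * s → c ∣ s → n ∣ r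
∣-cross {c} {n} cr≡ns c∣s = *-cancelˡ-∣ c (subst₂ _∣_ (*-comm n c) (sym cr≡ns) (*-monoʳ-∣ n c∣s))

∣-cross⇔ : ∀ {c n r s} .{{_ : NonZero c}} .{{_ : NonZero n}} → c * r ≡ n * s → (c ∣ s ⇔ n ∣ r)
∣-cross⇔ cr≡ns = mk⇔ (∣-cross cr≡ns) (∣-cross (sym cr≡ns))

∣-+ˡ⇔ : ∀ {d m n} → d ∣ m → (d ∣ m + n ⇔ d ∣ n)
∣-+ˡ⇔ d∣m = mk⇔ (λ d∣m+n → ∣m+n∣m⇒∣n d∣m+n d∣m) (∣m∣n⇒∣m+n d∣m)

coprime-∣-*⇔ : ∀ {n x t} → Coprime n x → (n ∣ x * t ⇔ n ∣ t)
coprime-∣-*⇔ {x = x} cop = mk⇔ (coprime-divisor cop) (∣n⇒∣m*n x)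

module _ {A : Set} {I P : A → Set} {Q : Set} (a : A) (Ia : I a) (P⇔Q : ∀ x → I x → P x ⇔ Q) where
  open Equivalence

  ∀-const⇔ : (∀ x → I x → P x) ⇔ Q
  ∀-const⇔ = mk⇔ (λ ∀P → to (P⇔Q a Ia) (∀P a Ia)) (λ q x Ix → from (P⇔Q x Ix) q)

  ∃-const⇔ : (∃[ x ] (I x × P x)) ⇔ Q
  ∃-const⇔ = mk⇔ (λ (x , Ix , Px) → to (P⇔Q x Ix) Px) (λ q → a , Ia , from (P⇔Q a Ia) q)

module LongDivisionProperties (B N : ℕ) .{{_ : NonZero N}} (x : ℕ) where
  open LongDivision B N x

  -- the number with base-B digits a_{s+1} ... a_{s+m}; block k j is digits (j * k) k
  digits : ℕ → ℕ → ℕ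
  digits s m = sumTo m (λ i → digit (s + i) * B ^ (m ∸ suc i))

  B*rem≡N*digit+rem : ∀ i → B * rem i ≡ N * digit i + rem (suc i)
  B*rem≡N*digit+rem i = begin
    B * rem i                                 ≡⟨ m≡m%n+[m/n]*n (B * rem i) N ⟩
    rem (suc i) + digit i * N                 ≡⟨ +-comm (rem (suc i)) (digit i * N) ⟩
    digit i * N + rem (suc i)                 ≡⟨ cong (_+ rem (suc i)) (*-comm (digit i) N) ⟩
    N * digit i + rem (suc i)                 ∎

  B^m*rem≡N*digits+rem : ∀ s m → B ^ m * rem s ≡ N * digits s m + rem (s + m)
  B^m*rem≡N*digits+rem s zero = begin
    1 * rem s          ≡⟨ *-identityˡ (rem s) ⟩
    rem s              ≡⟨ cong rem (+-identityʳ s) ⟨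
    rem (s + 0)        ≡⟨ cong (_+ rem (s + 0)) (*-zeroʳ N) ⟨
    N * 0 + rem (s + 0) ∎
  B^m*rem≡N*digits+rem s (suc m) = begin
    B * B ^ m * rem s                                      ≡⟨ *-assoc B (B ^ m) (rem s) ⟩
    B * (B ^ m * rem s)                                    ≡⟨ cong (B *_) (B^m*rem≡N*digits+rem s m) ⟩
    B * (N * digits s m + rem (s + m))                     ≡⟨ *-distribˡ-+ B (N * digits s m) (rem (s + m)) ⟩
    B * (N * digits s m) + B * rem (s + m)
      ≡⟨ cong₂ _+_ (x*[y*z]≡y*[x*z] B N (digits s m)) (B*rem≡N*digit+rem (s + m)) ⟩
    N * (B * digits s m) + (N * digit (s + m) + rem (suc (s + m)))
      ≡⟨ +-assoc (N * (B * digits s m)) _ _ ⟨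
    N * (B * digits s m) + N * digit (s + m) + rem (suc (s + m))
      ≡⟨ cong₂ _+_ (*-distribˡ-+ N _ _) (cong rem (+-suc s m)) ⟨
    N * (B * digits s m + digit (s + m)) + rem (s + suc m)
      ≡⟨ cong (λ t → N * t + rem (s + suc m)) (sumTo-horner B m (λ i → digit (s + i))) ⟨
    N * digits s (suc m) + rem (s + suc m)                 ∎

  rem<N : x < N → ∀ i → rem i < N
  rem<N x<N zero    = x<N
  rem<N x<N (suc i) = m%n<n (B * rem i) N

  rem≡B^i*x%N : x < N → ∀ i → rem i ≡ (B ^ i * x) % N
  rem≡B^i*x%N x<N i = begin
    rem i                        ≡⟨ m<n⇒m%n≡m (rem<N x<N i) ⟨
    rem i % N                    ≡⟨ [m+kn]%n≡m%n (rem i) (digits 0 i) N ⟨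
    (rem i + digits 0 i * N) % N ≡⟨ cong (_% N) (+-comm (rem i) (digits 0 i * N)) ⟩
    (digits 0 i * N + rem i) % N ≡⟨ cong (λ t → (t + rem i) % N) (*-comm (digits 0 i) N) ⟩
    (N * digits 0 i + rem i) % N ≡⟨ cong (_% N) (B^m*rem≡N*digits+rem 0 i) ⟨
    (B ^ i * x) % N              ∎

  rem-periodic : x < N → ∀ e → B ^ e % N ≡ 1 % N → rem e ≡ x
  rem-periodic x<N e B^e≡1 = begin
    rem e                          ≡⟨ rem≡B^i*x%N x<N e ⟩
    (B ^ e * x) % N                ≡⟨ %-distribˡ-* (B ^ e) x N ⟩
    ((B ^ e % N) * (x % N)) % N    ≡⟨ cong (λ t → (t * (x % N)) % N) B^e≡1 ⟩
    ((1 % N) * (x % N)) % N        ≡⟨ %-distribˡ-* 1 x N ⟨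
    (1 * x) % N                    ≡⟨ cong (_% N) (*-identityˡ x) ⟩
    x % N                          ≡⟨ m<n⇒m%n≡m x<N ⟩
    x                              ∎

  B^k*R≡N*S+R : x < N → ∀ d k → B ^ (d * k) % N ≡ 1 % N → B ^ k * R d k ≡ N * S d k + R d k
  B^k*R≡N*S+R x<N d k B^dk≡1 = begin
    B ^ k * R d k
      ≡⟨ *-distribˡ-sumTo (B ^ k) d _ ⟩
    sumTo d (λ j → B ^ k * rem (j * k))
      ≡⟨ sumTo-cong d (λ j → B^m*rem≡N*digits+rem (j * k) k) ⟩
    sumTo d (λ j → N * block k j + rem (j * k + k))
      ≡⟨ sumTo-+ d _ _ ⟩
    sumTo d (λ j → N * block k j) + sumTo d (λ j → rem (j * k + k))
      ≡⟨ cong₂ _+_ (*-distribˡ-sumTo N d _) next-R ⟨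
    N * S d k + R d k ∎
    where
    next-R : R d k ≡ sumTo d (λ j → rem (j * k + k))
    next-R = begin
      R d k                           ≡⟨ sumTo-rotate d (λ j → rem (j * k)) (rem-periodic x<N (d * k) B^dk≡1) ⟨
      sumTo d (λ j → rem (k + j * k)) ≡⟨ sumTo-cong d (λ j → cong rem (+-comm k (j * k))) ⟩
      sumTo d (λ j → rem (j * k + k)) ∎

  [B^k∸1]*R≡N*S : x < N → ∀ d k → B ^ (d * k) % N ≡ 1 % N → (B ^ k ∸ 1) * R d k ≡ N * S d k
  [B^k∸1]*R≡N*S x<N d k B^dk≡1 = begin
    (B ^ k ∸ 1) * R d k              ≡⟨ *-distribʳ-∸ (R d k) (B ^ k) 1 ⟩
    B ^ k * R d k ∸ 1 * R d k        ≡⟨ cong₂ _∸_ (B^k*R≡N*S+R x<N d k B^dk≡1) (*-identityˡ (R d k)) ⟩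
    N * S d k + R d k ∸ R d k        ≡⟨ m+n∸n≡m (N * S d k) (R d k) ⟩
    N * S d k                        ∎

  x*T≡N*Q+R : ∀ d k → x * sumTo d (λ j → B ^ (k * j)) ≡ N * sumTo d (λ j → digits 0 (j * k)) + R d k
  x*T≡N*Q+R d k = begin
    x * sumTo d (λ j → B ^ (k * j))                         ≡⟨ *-distribˡ-sumTo x d _ ⟩
    sumTo d (λ j → x * B ^ (k * j))                         ≡⟨ sumTo-cong d B^jk*x ⟩
    sumTo d (λ j → N * digits 0 (j * k) + rem (j * k))      ≡⟨ sumTo-+ d _ _ ⟩
    sumTo d (λ j → N * digits 0 (j * k)) + R d k            ≡⟨ cong (_+ R d k) (*-distribˡ-sumTo N d _) ⟨
    N * sumTo d (λ j → digits 0 (j * k)) + R d k            ∎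
    where
    B^jk*x : ∀ j → x * B ^ (k * j) ≡ N * digits 0 (j * k) + rem (j * k)
    B^jk*x j = begin
      x * B ^ (k * j)   ≡⟨ *-comm x _ ⟩
      B ^ (k * j) * x   ≡⟨ cong (λ t → B ^ t * x) (*-comm k j) ⟩
      B ^ (j * k) * x   ≡⟨ B^m*rem≡N*digits+rem 0 (j * k) ⟩
      N * digits 0 (j * k) + rem (j * k) ∎

  N∣R⇔N∣x*T : ∀ d k → N ∣ R d k ⇔ N ∣ x * sumTo d (λ j → B ^ (k * j))
  N∣R⇔N∣x*T d k =
    subst (λ t → N ∣ R d k ⇔ N ∣ t) (sym (x*T≡N*Q+R d k)) (⇔-sym (∣-+ˡ⇔ (m∣m*n _)))

theorem2 : (B N e d k : ℕ) .{{_ : NonZero N}} → 1 < B → 1 < N → Coprime N B →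
    IsOrd B N e → 0 < d → 0 < k → e ≡ d * k →
    ((InM B N d k ⇔ (∃[ x ] (InNStar N x × (B ^ k ∸ 1) ∣ LongDivision.S B N x d k)))
    × (InM B N d k ⇔ (∃[ x ] (InNStar N x × N ∣ LongDivision.R B N x d k)))
    × (InM B N d k ⇔ N ∣ sumTo d (λ j → B ^ (k * j))))
    × (Coprime (B ^ k ∸ 1) N → InM B N d k)
theorem2 B N e d k 1<B 1<N _ ((_ , B^e≡1) , _) _ 0<k refl =
  ( ⇔-trans InM⇔T (⇔-sym (∃-const⇔ 1 1∈N* S⇔T))
  , ⇔-trans InM⇔T (⇔-sym (∃-const⇔ 1 1∈N* R⇔T))
  , InM⇔T )
  , λ cop x (_ , x<N , _) → Equivalence.from (S⇔R x x<N)
      (coprime-divisor (Coprime.sym cop) (subst (N ∣_) (sym (cross x x<N)) (m∣m*n _)))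
  where
  module L = LongDivisionProperties B N
  open LongDivision B N using (R; S)

  T : ℕ
  T = sumTo d (λ j → B ^ (k * j))

  instance
    B^k∸1≢0 : NonZero (B ^ k ∸ 1)
    B^k∸1≢0 = >-nonZero (m<n⇒0<n∸m (^-monoʳ-< B 1<B 0<k))

  1∈N* : InNStar N 1
  1∈N* = ≤-refl , 1<N , 1-coprimeTo N

  cross : ∀ x → x < N → (B ^ k ∸ 1) * R x d k ≡ N * S x d k
  cross x x<N = L.[B^k∸1]*R≡N*S x x<N d k B^e≡1

  S⇔R : ∀ x → x < N → (B ^ k ∸ 1) ∣ S x d k ⇔ N ∣ R x d k
  S⇔R x x<N = ∣-cross⇔ (cross x x<N)

  R⇔T : ∀ x → InNStar N x → N ∣ R x d k ⇔ N ∣ T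
  R⇔T x (_ , _ , x⊥N) = ⇔-trans (L.N∣R⇔N∣x*T x d k) (coprime-∣-*⇔ (Coprime.sym x⊥N))

  S⇔T : ∀ x → InNStar N x → (B ^ k ∸ 1) ∣ S x d k ⇔ N ∣ T
  S⇔T x x∈N*@(_ , x<N , _) = ⇔-trans (S⇔R x x<N) (R⇔T x x∈N*)

  InM⇔T : InM B N d k ⇔ N ∣ T
  InM⇔T = ∀-const⇔ 1 1∈N* S⇔T
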